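{- Let $n\ge 1$ and let $h:\{1,\dots,n\}\to\{1,\dots,n\}$ be a weakly increasing function with $h(i)\ge i$ for all $i$. Let $G$ be the graph on vertex set $\{1,\dots,n\}$ whose edges are the pairs $\{i,j\}$ with $i<j\le h(i)$. Then for every acyclic orientation $o$ of $G$, the set of linear extensions of the partial order $P(o)$ contains exactly one Tymoczko configuration of shape $(n)$ for $h$; call it $\sigma_o$. The map $o\mapsto \sigma_o$ is a bijection from the set of acyclic orientations of $G$ onto the set of Tymoczko configurations of shape $(n)$ for $h$, and the number of $h$-inversions of $\sigma_o$ equals the number of edges $\{i<j\}$ of $G$ oriented by $o$ as the arc $j\to i$.
   Context: An acyclic orientation $o$ of $G$ assigns to each edge a direction $u\to v$ so that there are no directed cycles; $P(o)$ is the partial order on $\{1,\dots,n\}$ generated by $u<_{P(o)} v$ for each arc $u\to v$. A linear extension of $P(o)$ is a permutation $w_1w_2\cdots w_n$ of $\{1,\dots,n\}$ (written as a word) in which $u$ appears before $v$ whenever $u<_{P(o)}v$. A Tymoczko configuration of shape $(n)$ for $h$ is a permutation $w_1w_2\cdots w_n$ of $\{1,\dots,n\}$ such that $w_k\le h(w_{k+1})$ for every $1\le k<n$. An $h$-inversion of such a word is a pair $(a,b)$ with $a<b$ such that $b$ appears strictly to the left of $a$ and, if $a$ is immediately followed in the word by some letter $c$, then $b\le h(c)$. The number of $h$-inversions is the dimension of the corresponding cell in Tymoczko's affine paving of the regular nilpotent Hessenberg variety. -}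

module Defs where

open import Data.Nat as ℕ using (ℕ; suc)
open import Data.Nat.Properties as ℕP using ()
open import Data.Fin using (Fin; toℕ; _<_; _≤_)
open import Data.Fin.Properties using (_<?_; _≤?_; all?)
open import Data.Bool using (Bool; true; false)
open import Data.Bool.Properties using () renaming (_≟_ to _≟B_)
open import Data.Vec using (Vec; lookup)
open import Data.List using (List; length; filter; allFin; cartesianProduct)
open import Data.Product using (_×_; _,_; proj₁; proj₂)
open import Data.Sum using (_⊎_)
open import Relation.Nullary using (¬_; Dec)
open import Relation.Nullary.Decidable using (_×-dec_; _→-dec_)
open import Relation.Binary.PropositionalEquality using (_≡_)
open import Relation.Binary.Construct.Closure.Transitive using (TransClosure)

-- Conventions: vertices/letters {1,…,n} are represented by Fin n (0-indexed,
-- i ↦ i-1); h is transported accordingly (h'(i-1) = h(i)-1).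

Hess : ℕ → Set
Hess n = Fin n → Fin n

WeaklyIncreasing : ∀ {n} → Hess n → Set
WeaklyIncreasing h = ∀ i j → i ≤ j → h i ≤ h j

Edge : ∀ {n} → Hess n → Fin n → Fin n → Set
Edge h i j = (i < j) × (j ≤ h i)

edge? : ∀ {n} (h : Hess n) i j → Dec (Edge h i j)
edge? h i j = (i <? j) ×-dec (j ≤? h i)

-- An orientation: for each pair i < j, o i j ≡ true means the arc i → j,
-- o i j ≡ false means the arc j → i. Only the values on edges matter.
Orientation : ℕ → Set
Orientation n = Fin n → Fin n → Bool

SameOrientation : ∀ {n} → Hess n → Orientation n → Orientation n → Set
SameOrientation h o o′ = ∀ i j → Edge h i j → o i j ≡ o′ i j

Arc : ∀ {n} → Hess n → Orientation n → Fin n → Fin n → Set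
Arc h o u v = (Edge h u v × o u v ≡ true) ⊎ (Edge h v u × o v u ≡ false)

_<[_,_]_ : ∀ {n} → Fin n → Hess n → Orientation n → Fin n → Set
u <[ h , o ] v = TransClosure (Arc h o) u v

Acyclic : ∀ {n} → Hess n → Orientation n → Set
Acyclic h o = ∀ u → ¬ (u <[ h , o ] u)

-- Words of length n: position ↦ letter
Word : ℕ → Set
Word n = Vec (Fin n) n

IsPermutation : ∀ {n} → Word n → Set
IsPermutation w = ∀ p q → lookup w p ≡ lookup w q → p ≡ q

LinearExtension : ∀ {n} → Hess n → Orientation n → Word n → Set
LinearExtension h o w =
  IsPermutation w × (∀ p q → lookup w p <[ h , o ] lookup w q → p < q)

Next : ∀ {n} → Fin n → Fin n → Set
Next p q = suc (toℕ p) ≡ toℕ q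

Tymoczko : ∀ {n} → Hess n → Word n → Set
Tymoczko h w = IsPermutation w × (∀ p q → Next p q → lookup w p ≤ h (lookup w q))

HInversion : ∀ {n} → Hess n → Word n → Fin n × Fin n → Set
HInversion h w (p , q) =
  (p < q) × (lookup w q < lookup w p) ×
  (∀ r → Next q r → lookup w p ≤ h (lookup w r))

hInversion? : ∀ {n} (h : Hess n) (w : Word n) x → Dec (HInversion h w x)
hInversion? h w (p , q) =
  (p <? q) ×-dec (lookup w q <? lookup w p) ×-dec
  all? (λ r → (suc (toℕ q) ℕP.≟ toℕ r) →-dec (lookup w p ≤? h (lookup w r)))

allPairs : ∀ n → List (Fin n × Fin n)
allPairs n = cartesianProduct (allFin n) (allFin n)

hinv : ∀ {n} → Hess n → Word n → ℕ
hinv {n} h w = length (filter (hInversion? h w) (allPairs n))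

Descending : ∀ {n} → Hess n → Orientation n → Fin n × Fin n → Set
Descending h o (i , j) = Edge h i j × o i j ≡ false

descending? : ∀ {n} (h : Hess n) (o : Orientation n) x → Dec (Descending h o x)
descending? h o (i , j) = edge? h i j ×-dec (o i j ≟B false)

descendingEdges : ∀ {n} → Hess n → Orientation n → ℕ
descendingEdges {n} h o = length (filter (descending? h o) (allPairs n))

{-# OPTIONS --safe #-}
module Submission where

open import Defs
open import Data.Nat using (ℕ; _≥_)
open import Data.Fin using (_≤_)
open import Data.Product using (_×_; ∃; ∃!)
open import Relation.Binary.PropositionalEquality using (_≡_)

open import Data.Nat as ℕ using (_+_)
import Data.Nat.Properties as ℕP
open import Algebra.Properties.CommutativeMonoid.Sum ℕP.+-0-commutativeMonoid
  using (sum; sum-syntax; ∑-distrib-+; ∑-comm; sum-permute; sum-init-last; sum-cong-≗)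
open import Algebra.Properties.CommutativeSemigroup ℕP.+-commutativeSemigroup using (interchange)
open import Data.Bool using (true; false; if_then_else_)
import Data.Bool.Properties as Bool
open import Data.Empty using (⊥; ⊥-elim)
open import Data.Fin using (Fin; zero; suc; toℕ; _<_; fromℕ; fromℕ<; inject₁; punchOut)
open import Data.Fin.Induction using (>-weakInduction; <-wellFounded)
open import Data.Fin.Permutation using (permutation)
open import Data.Fin.Properties
  using (_≟_; _<?_; _≤?_; any?; all?; <-cmp; <-irrefl; <-asym; <-trans; ≤-refl; ≤-trans; ≤∧≢⇒<;
         ≤fromℕ; toℕ<n; toℕ-fromℕ; toℕ-injective; toℕ-inject₁; ℕ<⇒inject₁<; fromℕ<-injective;
         pigeonhole; injective⇒≤; punchOut-injective)
open import Data.List as List using (length; filter; cartesianProduct; _++_)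
open import Data.List.Properties using (length-++; filter-++; map-tabulate)
open import Data.Product using (_,_; proj₁; proj₂; ∃₂; uncurry)
open import Data.Sum using (inj₁; inj₂)
open import Data.Unit using (⊤; tt)
open import Data.Vec using (lookup; tabulate)
open import Data.Vec.Properties using (lookup∘tabulate; tabulate∘lookup; tabulate-cong)
open import Function.Base using (_on_; _∘_; _$_; id)
open import Function.Bundles using (_⇔_; mk⇔)
open import Function.Definitions using (Injective)
open import Induction.WellFounded using (module All)
open import Level using (0ℓ)
open import Relation.Binary.Construct.Closure.Transitive using (TransClosure; [_]; _∷_)
open import Relation.Binary.Core using (Rel; _⇒_)
open import Relation.Binary.Definitions using (Decidable; tri<; tri≈; tri>)
open import Relation.Binary.PropositionalEquality
  using (refl; sym; trans; cong; cong₂; subst; subst₂; _≢_; module ≡-Reasoning)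
open import Relation.Nullary using (¬_; Dec; does; proof; yes; no; contradiction)
open import Relation.Nullary.Decidable
  using (_×-dec_; _→-dec_; _⊎-dec_; ¬?; dec-true; dec-false; does-⇔)
open import Relation.Nullary.Reflects using (Reflects; invert)
open import Relation.Unary as U using (Pred)

-- σ_o is the word produced by least-source-first topological sorting of o: repeatedly write
-- down the smallest vertex having no in-neighbour among the vertices not yet written.  If this
-- word descends at consecutive positions, w_p > w_{p+1}, then w_{p+1} was blocked at step p and
-- free at step p + 1, so w_p → w_{p+1} is an arc; an arc from w_p down to w_{p+1} means
-- w_p ≤ h(w_{p+1}), which is Tymoczko's condition.  Uniqueness rests on a descent lemma valid in
-- every Tymoczko word when h is weakly increasing: if i < j and w_j < w_i, some s ∈ [i, j) has
-- w_j < w_s ≤ h(w_j), so {w_j, w_s} is an edge that the word orients from w_s to w_j.  At the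
-- first position where two Tymoczko linear extensions differ this yields an edge they order
-- oppositely.  A linear extension determines o on every edge, which gives injectivity, and every
-- permutation is a linear extension of the acyclic orientation it induces.
--
-- For the dimension, count for each position a the earlier letters that are at most h(w_a), and
-- those that are at most h(w_{a+1}).  Discarding the earlier letters below w_a leaves the reversed
-- edges ending at w_a, respectively the h-inversions whose smaller letter sits at a.  Passing from
-- a to a + 1 adds exactly the letter w_a to the second count (as w_a ≤ h(w_{a+1})), so both
-- totals telescope to the same number.

-- Finite sets

injective⇒surjective : ∀ {n} (f : Fin n → Fin n) → Injective _≡_ _≡_ f →
                       ∀ y → ∃ λ x → f x ≡ y
injective⇒surjective {ℕ.zero} f f-inj ()
injective⇒surjective {ℕ.suc n} f f-inj y with any? (λ x → f x ≟ y)
... | yes found = found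
... | no missed = contradiction (injective⇒≤ punchOut∘f-injective) ℕP.1+n≰n
  where
  f≢y : ∀ x → y ≢ f x
  f≢y x eq = missed (x , sym eq)
  punchOut∘f-injective : Injective _≡_ _≡_ (λ x → punchOut (f≢y x))
  punchOut∘f-injective eq = f-inj (punchOut-injective (f≢y _) (f≢y _) eq)

leastWitness : ∀ {n p} {P : Pred (Fin n) p} → U.Decidable P → ∃ P →
               ∃ λ x → P x × (∀ {y} → y < x → ¬ P y)
leastWitness {ℕ.zero}  P? (() , _)
leastWitness {ℕ.suc n} P? witness with P? zero
leastWitness {ℕ.suc n} P? _             | yes P0 = zero , P0 , λ ()
leastWitness {ℕ.suc n} P? (zero , P0)   | no ¬P0 = contradiction P0 ¬P0
leastWitness {ℕ.suc n} P? (suc x , Psx) | no ¬P0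
  with y , Psy , below ← leastWitness (P? ∘ suc) (x , Psx) =
  suc y , Psy , λ { {zero} _ → ¬P0 ; {suc z} (ℕ.s≤s z<y) → below z<y }

increasing⁺ : ∀ {a ℓ m} {A : Set a} {R : Rel A ℓ} (rank : A → Fin m) →
              R ⇒ (_<_ on rank) → TransClosure R ⇒ (_<_ on rank)
increasing⁺ rank increasing [ r ]    = increasing r
increasing⁺ rank increasing (r ∷ rs) = <-trans (increasing r) (increasing⁺ rank increasing rs)

backwardChain⇒path : ∀ {a ℓ} {A : Set a} {R : Rel A ℓ} (c : ℕ → A) →
  (∀ k → R (c (ℕ.suc k)) (c k)) → ∀ {i j} → i ℕ.< j → TransClosure R (c j) (c i)
backwardChain⇒path c step {i} {ℕ.suc j} (ℕ.s≤s i≤j) with ℕP.m≤n⇒m<n∨m≡n i≤j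
... | inj₁ i<j  = step j ∷ backwardChain⇒path c step i<j
... | inj₂ refl = [ step j ]

next-inject₁ : ∀ {n} (i : Fin n) → Next (inject₁ i) (suc i)
next-inject₁ i = cong ℕ.suc (toℕ-inject₁ i)

does-true : ∀ {a} {A : Set a} (a? : Dec A) → does a? ≡ true → A
does-true a? eq = invert (subst (Reflects _) eq (proof a?))

does-false : ∀ {a} {A : Set a} (a? : Dec A) → does a? ≡ false → ¬ A
does-false a? eq = invert (subst (Reflects _) eq (proof a?))

-- Counting with indicators

𝟙 : ∀ {p} {P : Set p} → Dec P → ℕ
𝟙 P? = if does P? then 1 else 0

𝟙-cong : ∀ {p q} {P : Set p} {Q : Set q} → P ⇔ Q → (P? : Dec P) (Q? : Dec Q) → 𝟙 P? ≡ 𝟙 Q?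
𝟙-cong P⇔Q P? Q? = cong (λ b → if b then 1 else 0) (does-⇔ P⇔Q P? Q?)

𝟙-yes : ∀ {p} {P : Set p} (P? : Dec P) → P → 𝟙 P? ≡ 1
𝟙-yes P? p rewrite dec-true P? p = refl

count-tabulate : ∀ {a p n} {A : Set a} {P : Pred A p} (P? : U.Decidable P) (f : Fin n → A) →
  length (filter P? (List.tabulate f)) ≡ ∑[ i < n ] 𝟙 (P? (f i))
count-tabulate {n = ℕ.zero}  P? f = refl
count-tabulate {n = ℕ.suc n} P? f with P? (f zero)
... | yes _ = cong ℕ.suc (count-tabulate P? (f ∘ suc))
... | no _  = count-tabulate P? (f ∘ suc)

count-cartesianProduct : ∀ {a b p m n} {A : Set a} {B : Set b} {P : Pred (A × B) p} (P? : U.Decidable P)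
  (f : Fin m → A) (g : Fin n → B) →
  length (filter P? (cartesianProduct (List.tabulate f) (List.tabulate g))) ≡
  ∑[ i < m ] ∑[ j < n ] 𝟙 (P? (f i , g j))
count-cartesianProduct {m = ℕ.zero}  P? f g = refl
count-cartesianProduct {m = ℕ.suc m} P? f g = begin
  length (filter P? (first ++ rest))
    ≡⟨ cong length (filter-++ P? first rest) ⟩
  length (filter P? first ++ filter P? rest)
    ≡⟨ length-++ (filter P? first) ⟩
  length (filter P? first) + length (filter P? rest)
    ≡⟨ cong₂ _+_ count-first (count-cartesianProduct P? (f ∘ suc) g) ⟩
  (∑[ j < _ ] 𝟙 (P? (f zero , g j))) + (∑[ i < m ] ∑[ j < _ ] 𝟙 (P? (f (suc i) , g j))) ∎
  where
  open ≡-Reasoning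
  first = List.map (f zero ,_) (List.tabulate g)
  rest  = cartesianProduct (List.tabulate (f ∘ suc)) (List.tabulate g)
  count-first : length (filter P? first) ≡ ∑[ j < _ ] 𝟙 (P? (f zero , g j))
  count-first = trans (cong (length ∘ filter P?) (map-tabulate g (f zero ,_)))
                      (count-tabulate P? ((f zero ,_) ∘ g))

countBefore : ∀ {n p} {P : Pred (Fin n) p} → Fin n → U.Decidable P → ℕ
countBefore a P? = ∑[ b < _ ] 𝟙 ((b <? a) ×-dec P? b)

countBefore-zero : ∀ {n p} {P : Pred (Fin (ℕ.suc n)) p} (P? : U.Decidable P) → countBefore zero P? ≡ 0
countBefore-zero {ℕ.zero}  P? = refl
countBefore-zero {ℕ.suc n} P? = countBefore-zero {n} (P? ∘ suc)

-- (suc b <? suc a) and (b <? a) have the same outcome definitionally, so counts before a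
-- position unfold along the recursion on that position.
countBefore-suc : ∀ {n p} {P : Pred (Fin (ℕ.suc n)) p} (P? : U.Decidable P) (a : Fin n) →
  countBefore (suc a) P? ≡ countBefore (inject₁ a) P? + 𝟙 (P? (inject₁ a))
countBefore-suc P? zero = begin
  𝟙 (P? zero) + countBefore zero (P? ∘ suc) ≡⟨ cong (𝟙 (P? zero) +_) (countBefore-zero (P? ∘ suc)) ⟩
  𝟙 (P? zero) + 0                          ≡⟨ ℕP.+-comm _ 0 ⟩
  0 + 𝟙 (P? zero)                          ≡⟨ cong (_+ 𝟙 (P? zero)) (countBefore-zero P?) ⟨
  countBefore zero P? + 𝟙 (P? zero)        ∎
  where open ≡-Reasoning
countBefore-suc P? (suc a) = begin
  𝟙 (P? zero) + countBefore (suc a) (P? ∘ suc)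
    ≡⟨ cong (𝟙 (P? zero) +_) (countBefore-suc (P? ∘ suc) a) ⟩
  𝟙 (P? zero) + (countBefore (inject₁ a) (P? ∘ suc) + 𝟙 (P? (suc (inject₁ a))))
    ≡⟨ ℕP.+-assoc (𝟙 (P? zero)) _ _ ⟨
  countBefore (suc (inject₁ a)) P? + 𝟙 (P? (suc (inject₁ a))) ∎
  where open ≡-Reasoning

countBefore-all : ∀ {n p} {P : Pred (Fin n) p} (P? : U.Decidable P) → (∀ b → P b) →
  ∀ a → countBefore a P? ≡ toℕ a
countBefore-all P? all-P zero    = countBefore-zero P?
countBefore-all P? all-P (suc a) =
  cong₂ _+_ (𝟙-yes (P? zero) (all-P zero)) (countBefore-all (P? ∘ suc) (all-P ∘ suc) a)

𝟙-threshold : ∀ {a k} {A : Set a} {x X Y : Fin k} → Y ≤ X →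
  (A? : Dec A) (x≤X? : Dec (x ≤ X)) (x≤Y? : Dec (x ≤ Y)) (Y<x? : Dec (Y < x)) →
  𝟙 (A? ×-dec x≤X?) ≡ 𝟙 (A? ×-dec x≤Y?) + 𝟙 (A? ×-dec (Y<x? ×-dec x≤X?))
𝟙-threshold Y≤X (no _)  _          _          _          = refl
𝟙-threshold Y≤X (yes _) _          (yes x≤Y)  (yes Y<x)  = contradiction x≤Y (ℕP.<⇒≱ Y<x)
𝟙-threshold Y≤X (yes _) (yes _)    (yes _)    (no _)     = refl
𝟙-threshold Y≤X (yes _) (no x≰X)   (yes x≤Y)  (no _)     = contradiction (≤-trans x≤Y Y≤X) x≰X
𝟙-threshold Y≤X (yes _) _          (no _)     (yes _)    = refl
𝟙-threshold Y≤X (yes _) _          (no x≰Y)   (no Y≮x)   = contradiction (ℕP.≮⇒≥ Y≮x) x≰Y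

countBefore-split : ∀ {n k} (f : Fin n → Fin k) {X Y : Fin k} → Y ≤ X → ∀ a →
  countBefore a (λ b → f b ≤? X) ≡
  countBefore a (λ b → f b ≤? Y) + countBefore a (λ b → (Y <? f b) ×-dec (f b ≤? X))
countBefore-split f {X} {Y} Y≤X a = trans
  (sum-cong-≗ λ b → 𝟙-threshold Y≤X (b <? a) (f b ≤? X) (f b ≤? Y) (Y <? f b))
  (∑-distrib-+ (λ b → 𝟙 ((b <? a) ×-dec (f b ≤? Y)))
                (λ b → 𝟙 ((b <? a) ×-dec ((Y <? f b) ×-dec (f b ≤? X)))))

∑-shift : ∀ {m} (f : Fin (ℕ.suc m) → ℕ) (g : Fin m → ℕ) →
  f zero ≡ 0 → (∀ i → f (suc i) ≡ g i + 1) → sum f ≡ sum g + m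
∑-shift {m} f g f0≡0 f-suc = begin
  f zero + sum (f ∘ suc)            ≡⟨ cong₂ _+_ f0≡0 (sum-cong-≗ f-suc) ⟩
  sum (λ i → g i + 1)              ≡⟨ ∑-distrib-+ g (λ _ → 1) ⟩
  sum g + sum {m} (λ _ → 1)        ≡⟨ cong (sum g +_) (∑-ones m) ⟩
  sum g + m                        ∎
  where
  open ≡-Reasoning
  ∑-ones : ∀ k → sum {k} (λ _ → 1) ≡ k
  ∑-ones ℕ.zero    = refl
  ∑-ones (ℕ.suc k) = cong ℕ.suc (∑-ones k)

-- Least-source-first topological sorting

IsSource : ∀ {n} → Rel (Fin n) 0ℓ → Pred (Fin n) 0ℓ → Pred (Fin n) 0ℓ
IsSource R S v = S v × (∀ u → S u → ¬ R u v)

isSource? : ∀ {n} {R : Rel (Fin n) 0ℓ} {S} → Decidable R → U.Decidable S → U.Decidable (IsSource R S)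
isSource? R? S? v = S? v ×-dec all? (λ u → S? u →-dec ¬? (R? u v))

nonempty⇒source : ∀ {n} {R : Rel (Fin n) 0ℓ} {S} → Decidable R → U.Decidable S →
  (∀ u → ¬ TransClosure R u u) → ∃ S → ∃ (IsSource R S)
nonempty⇒source {n} {R} {S} R? S? acyclic (x , Sx) with any? (isSource? R? S?)
... | yes source = source
... | no none = ⊥-elim (uncurry acyclic (collision⇒cycle (pigeonhole (ℕP.n<1+n n) (c ∘ toℕ))))
  where
  predecessor : ((v , _) : ∃ S) → ∃ λ u → S u × R u v
  predecessor (v , Sv) with any? (λ u → S? u ×-dec R? u v)
  ... | yes found = found
  ... | no nothing = contradiction (v , Sv , λ u Su Ruv → nothing (u , Su , Ruv)) none

  chain : ℕ → ∃ S
  chain ℕ.zero    = x , Sx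
  chain (ℕ.suc k) = let (u , Su , _) = predecessor (chain k) in u , Su

  c : ℕ → Fin n
  c = proj₁ ∘ chain

  collision⇒cycle : (∃₂ λ (i j : Fin (ℕ.suc n)) → i < j × c (toℕ i) ≡ c (toℕ j)) →
                    ∃ λ v → TransClosure R v v
  collision⇒cycle (i , j , i<j , same) =
    _ , subst (TransClosure R (c (toℕ j))) same
          (backwardChain⇒path c (proj₂ ∘ proj₂ ∘ predecessor ∘ chain) i<j)

module LeastSourceFirst {m} {R : Rel (Fin (ℕ.suc m)) 0ℓ} (R? : Decidable R)
                        (acyclic : ∀ u → ¬ TransClosure R u u) where

  -- The fallback zero is a junk value: it is returned only when S has no source,
  -- which by nonempty⇒source happens only for S empty.
  leastSource : ∀ {S} → U.Decidable S → Fin (ℕ.suc m)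
  leastSource S? with any? (isSource? R? S?)
  ... | yes source = proj₁ (leastWitness (isSource? R? S?) source)
  ... | no _       = zero

  leastSource-spec : ∀ {S} (S? : U.Decidable S) → ∃ S →
    IsSource R S (leastSource S?) × (∀ {y} → y < leastSource S? → ¬ IsSource R S y)
  leastSource-spec S? nonempty with any? (isSource? R? S?)
  ... | yes source = proj₂ (leastWitness (isSource? R? S?) source)
  ... | no none    = contradiction (nonempty⇒source R? S? acyclic nonempty) none

  mutual
    Remaining : ℕ → Pred (Fin (ℕ.suc m)) 0ℓ
    Remaining ℕ.zero    v = ⊤
    Remaining (ℕ.suc k) v = Remaining k v × v ≢ pick k

    remaining? : ∀ k → U.Decidable (Remaining k)
    remaining? ℕ.zero    v = yes tt
    remaining? (ℕ.suc k) v = remaining? k v ×-dec ¬? (v ≟ pick k)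

    pick : ℕ → Fin (ℕ.suc m)
    pick k = leastSource (remaining? k)

  remaining-antitone : ∀ {k l v} → k ℕ.≤ l → Remaining l v → Remaining k v
  remaining-antitone {l = ℕ.zero}  ℕ.z≤n r = r
  remaining-antitone {l = ℕ.suc l} k≤l+1 r with ℕP.m≤n⇒m<n∨m≡n k≤l+1
  ... | inj₁ (ℕ.s≤s k≤l) = remaining-antitone k≤l (proj₁ r)
  ... | inj₂ refl        = r

  picked-not-remaining : ∀ {i k} → i ℕ.< k → ¬ Remaining k (pick i)
  picked-not-remaining i<k r = proj₂ (remaining-antitone i<k r) refl

  not-remaining⇒picked : ∀ k v → ¬ Remaining k v → ∃ λ i → i ℕ.< k × pick i ≡ v
  not-remaining⇒picked ℕ.zero v ¬r = contradiction tt ¬r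
  not-remaining⇒picked (ℕ.suc k) v ¬r with remaining? k v | v ≟ pick k
  ... | no ¬rk | _        =
    let (i , i<k , eq) = not-remaining⇒picked k v ¬rk in i , ℕP.m<n⇒m<1+n i<k , eq
  ... | yes _  | yes v≡pk = k , ℕP.n<1+n k , sym v≡pk
  ... | yes rk | no v≢pk  = contradiction (rk , v≢pk) ¬r

  remaining-nonempty : ∀ k → k ℕ.< ℕ.suc m → ∃ (Remaining k)
  remaining-nonempty k k<n with any? (remaining? k)
  ... | yes found = found
  ... | no none   = contradiction (injective⇒≤ index-injective) (ℕP.<⇒≱ k<n)
    where
    picked : ∀ v → ∃ λ i → i ℕ.< k × pick i ≡ v
    picked v = not-remaining⇒picked k v (λ r → none (v , r))
    index : Fin (ℕ.suc m) → Fin k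
    index v = fromℕ< (proj₁ (proj₂ (picked v)))
    index-injective : Injective _≡_ _≡_ index
    index-injective {u} {v} eq = begin
      u                       ≡⟨ proj₂ (proj₂ (picked u)) ⟨
      pick (proj₁ (picked u)) ≡⟨ cong pick (fromℕ<-injective _ _ _ _ eq) ⟩
      pick (proj₁ (picked v)) ≡⟨ proj₂ (proj₂ (picked v)) ⟩
      v                       ∎
      where open ≡-Reasoning

  pick-isLeastSource : ∀ k → k ℕ.< ℕ.suc m →
    IsSource R (Remaining k) (pick k) × (∀ {y} → y < pick k → ¬ IsSource R (Remaining k) y)
  pick-isLeastSource k k<n = leastSource-spec (remaining? k) (remaining-nonempty k k<n)

  pick-remaining : ∀ {k l} → k ℕ.≤ l → l ℕ.< ℕ.suc m → Remaining k (pick l)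
  pick-remaining k≤l l<n = remaining-antitone k≤l (proj₁ (proj₁ (pick-isLeastSource _ l<n)))

  order : Fin (ℕ.suc m) → Fin (ℕ.suc m)
  order p = pick (toℕ p)

  order-injective : Injective _≡_ _≡_ order
  order-injective {p} {q} eq with <-cmp p q
  ... | tri< p<q _ _ = ⊥-elim $ picked-not-remaining p<q
                         (subst (Remaining (toℕ q)) (sym eq) (pick-remaining ℕP.≤-refl (toℕ<n q)))
  ... | tri≈ _ p≡q _ = p≡q
  ... | tri> _ _ q<p = ⊥-elim $ picked-not-remaining q<p
                         (subst (Remaining (toℕ p)) eq (pick-remaining ℕP.≤-refl (toℕ<n p)))

  order-forward : ∀ p q → R (order p) (order q) → p < q
  order-forward p q r with p <? q
  ... | yes p<q = p<q
  ... | no p≮q  = ⊥-elim $ proj₂ (proj₁ (pick-isLeastSource (toℕ q) (toℕ<n q)))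
                    (order p) (pick-remaining (ℕP.≮⇒≥ p≮q) (toℕ<n p)) r

  -- order q was passed over at step p although smaller than order p, so it still had an
  -- in-neighbour then; at step p + 1 it has none, so that in-neighbour is order p.
  consecutive-descent⇒arc : ∀ p q → Next p q → order q < order p → R (order p) (order q)
  consecutive-descent⇒arc p q next q<p with any? (λ u → remaining? (toℕ p) u ×-dec R? u (order q))
  ... | no none = contradiction
        (pick-remaining (ℕP.<⇒≤ (ℕP.≤-reflexive next)) (toℕ<n q) , λ u ru r → none (u , ru , r))
        (proj₂ (pick-isLeastSource (toℕ p) (toℕ<n p)) q<p)
  ... | yes (u , ru , r) with u ≟ order p
  ...   | yes refl = r
  ...   | no u≢p   = contradiction r (proj₂ q-source-after-p u (ru , u≢p))
    where
    q-source-after-p : IsSource R (Remaining (ℕ.suc (toℕ p))) (order q)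
    q-source-after-p = subst (λ l → IsSource R (Remaining l) (order q)) (sym next)
                         (proj₁ (pick-isLeastSource (toℕ q) (toℕ<n q)))

leastSourceFirst : ∀ {m} {R : Rel (Fin (ℕ.suc m)) 0ℓ} → Decidable R →
  (∀ u → ¬ TransClosure R u u) →
  ∃ λ (w : Word (ℕ.suc m)) → IsPermutation w × (∀ p q → R (lookup w p) (lookup w q) → p < q) ×
    (∀ p q → Next p q → lookup w q < lookup w p → R (lookup w p) (lookup w q))
leastSourceFirst {R = R} R? acyclic =
  tabulate order ,
  (λ p q eq → order-injective (trans (sym (lookup-order p)) (trans eq (lookup-order q)))) ,
  (λ p q r → order-forward p q (subst₂ R (lookup-order p) (lookup-order q) r)) ,
  λ p q next q<p → subst₂ R (sym (lookup-order p)) (sym (lookup-order q))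
    (consecutive-descent⇒arc p q next (subst₂ _<_ (lookup-order q) (lookup-order p) q<p))
  where
  open LeastSourceFirst R? acyclic
  lookup-order : ∀ p → lookup (tabulate order) p ≡ order p
  lookup-order = lookup∘tabulate order

-- Linear extensions of P(o)

module Positions {n} (w : Word n) (perm : IsPermutation w) where

  position : Fin n → Fin n
  position x = proj₁ (injective⇒surjective (lookup w) (perm _ _) x)

  lookup-position : ∀ x → lookup w (position x) ≡ x
  lookup-position x = proj₂ (injective⇒surjective (lookup w) (perm _ _) x)

  position-lookup : ∀ p → position (lookup w p) ≡ p
  position-lookup p = perm _ _ (lookup-position (lookup w p))

module _ {n} {h : Hess n} {o : Orientation n} (w : Word n) where

  arcsForward⇒linearExtension : IsPermutation w →
    (∀ p q → Arc h o (lookup w p) (lookup w q) → p < q) → LinearExtension h o w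
  arcsForward⇒linearExtension perm forward = perm , λ p q p<q →
    subst₂ _<_ (position-lookup p) (position-lookup q) (increasing⁺ position arc⇒< p<q)
    where
    open Positions w perm
    arc⇒< : Arc h o ⇒ (_<_ on position)
    arc⇒< {u} {v} a = forward _ _ (subst₂ (Arc h o) (sym (lookup-position u)) (sym (lookup-position v)) a)

  arcsForward⇒acyclic : IsPermutation w →
    (∀ p q → Arc h o (lookup w p) (lookup w q) → p < q) → Acyclic h o
  arcsForward⇒acyclic perm forward u cycle =
    <-irrefl refl (proj₂ (arcsForward⇒linearExtension perm forward) _ _ cycle′)
    where
    open Positions w perm
    cycle′ : lookup w (position u) <[ h , o ] lookup w (position u)
    cycle′ = subst₂ (_<[ h , o ]_) (sym (lookup-position u)) (sym (lookup-position u)) cycle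

  orientation-by-order : LinearExtension h o w → ∀ p q → Edge h (lookup w p) (lookup w q) →
    o (lookup w p) (lookup w q) ≡ does (p <? q)
  orientation-by-order (_ , order) p q e with o (lookup w p) (lookup w q) in eq
  ... | true  = sym (dec-true (p <? q) (order p q [ inj₁ (e , eq) ]))
  ... | false = sym (dec-false (p <? q) (<-asym (order q p [ inj₂ (e , eq) ])))

module InducedOrientation {n} (h : Hess n) (w : Word n) (perm : IsPermutation w) where
  open Positions w perm

  inducedOrientation : Orientation n
  inducedOrientation i j = does (position i <? position j)

  induced-forward : ∀ p q → Arc h inducedOrientation (lookup w p) (lookup w q) → p < q
  induced-forward p q (inj₁ (_ , p-first)) =
    subst₂ _<_ (position-lookup p) (position-lookup q) (does-true (_ <? _) p-first)
  induced-forward p q (inj₂ ((q<p , _) , q-not-first)) = ≤∧≢⇒< (ℕP.≮⇒≥ q≮p) p≢q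
    where
    q≮p : ¬ q < p
    q≮p = subst₂ (λ a b → ¬ a < b) (position-lookup q) (position-lookup p)
                 (does-false (_ <? _) q-not-first)
    p≢q : p ≢ q
    p≢q refl = <-irrefl refl q<p

  sameOrientation-induced : ∀ {o} → LinearExtension h o w → SameOrientation h o inducedOrientation
  sameOrientation-induced {o} le i j e = begin
    o i j                       ≡⟨ cong₂ o (sym (lookup-position i)) (sym (lookup-position j)) ⟩
    o (lookup w p) (lookup w q) ≡⟨ orientation-by-order w le p q e′ ⟩
    does (p <? q)               ∎
    where
    open ≡-Reasoning
    p = position i
    q = position j
    e′ : Edge h (lookup w p) (lookup w q)
    e′ = subst₂ (Edge h) (sym (lookup-position i)) (sym (lookup-position j)) e

linearExtensions-agree : ∀ {n} {h : Hess n} {o o′ : Orientation n} (w : Word n) →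
  LinearExtension h o w → LinearExtension h o′ w → SameOrientation h o o′
linearExtensions-agree {h = h} w le le′ i j e =
  trans (sameOrientation-induced le i j e) (sym (sameOrientation-induced le′ i j e))
  where open InducedOrientation h w (proj₁ le)

permutation⇒linearExtension : ∀ {n} (h : Hess n) (w : Word n) → IsPermutation w →
  ∃ λ o → Acyclic h o × LinearExtension h o w
permutation⇒linearExtension h w perm =
  inducedOrientation , arcsForward⇒acyclic w perm induced-forward ,
  arcsForward⇒linearExtension w perm induced-forward
  where open InducedOrientation h w perm

-- Tymoczko linear extensions

TymoczkoExtension : ∀ {n} → Hess n → Orientation n → Word n → Set
TymoczkoExtension h o w = LinearExtension h o w × Tymoczko h w

arc? : ∀ {n} (h : Hess n) (o : Orientation n) → Decidable (Arc h o)
arc? h o u v = (edge? h u v ×-dec (o u v Bool.≟ true)) ⊎-dec (edge? h v u ×-dec (o v u Bool.≟ false))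

descentsAreArcs⇒tymoczko : ∀ {n} {h : Hess n} {o : Orientation n} (w : Word n) → (∀ i → i ≤ h i) →
  IsPermutation w → (∀ p q → Next p q → lookup w q < lookup w p → Arc h o (lookup w p) (lookup w q)) →
  Tymoczko h w
descentsAreArcs⇒tymoczko {h = h} {o} w diag perm descent-arc = perm , bounded
  where
  bounded : ∀ p q → Next p q → lookup w p ≤ h (lookup w q)
  bounded p q next with lookup w p ≤? lookup w q
  ... | yes wp≤wq = ≤-trans wp≤wq (diag (lookup w q))
  ... | no wp≰wq  with descent-arc p q next (ℕP.≰⇒> wp≰wq)
  ...   | inj₁ ((wp<wq , _) , _) = contradiction wp<wq (ℕP.<⇒≯ (ℕP.≰⇒> wp≰wq))
  ...   | inj₂ ((_ , wp≤hwq) , _) = wp≤hwq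

tymoczkoExtension-exists : ∀ {m} {h : Hess (ℕ.suc m)} {o : Orientation (ℕ.suc m)} →
  (∀ i → i ≤ h i) → Acyclic h o → ∃ (TymoczkoExtension h o)
tymoczkoExtension-exists {h = h} {o} diag acyclic =
  let (w , perm , forward , descent-arc) = leastSourceFirst {R = Arc h o} (arc? h o) acyclic in
  w , arcsForward⇒linearExtension {h = h} {o} w perm forward ,
  descentsAreArcs⇒tymoczko {h = h} {o} w diag perm descent-arc

DescentWitness : ∀ {n} → Hess n → Word n → Fin n → Fin n → Set
DescentWitness h w i j = ∃ λ s → i ≤ s × s < j × Edge h (lookup w j) (lookup w s)

module _ {m} {h : Hess (ℕ.suc m)} (mono : WeaklyIncreasing h) (w : Word (ℕ.suc m)) (tym : Tymoczko h w) where

  descent : ∀ i j → i < j → lookup w j < lookup w i → DescentWitness h w i j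
  descent = >-weakInduction P last-impossible step
    where
    P : Fin (ℕ.suc m) → Set
    P i = ∀ j → i < j → lookup w j < lookup w i → DescentWitness h w i j

    last-impossible : P (fromℕ _)
    last-impossible j last<j _ = contradiction (≤fromℕ j) (ℕP.<⇒≱ last<j)

    step : ∀ i → P (suc i) → P (inject₁ i)
    step i ih j i<j wj<wi with lookup w (suc i) ≤? lookup w j
    ... | yes wi+1≤wj = inject₁ i , ≤-refl , i<j , wj<wi ,
          ≤-trans (proj₂ tym (inject₁ i) (suc i) (next-inject₁ i)) (mono _ _ wi+1≤wj)
    ... | no wi+1≰wj = widen (ih j i+1<j wj<wi+1)
      where
      widen : DescentWitness h w (suc i) j → DescentWitness h w (inject₁ i) j
      widen (s , i+1≤s , rest) = s , ℕP.<⇒≤ (ℕ<⇒inject₁< i+1≤s) , rest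

      wj<wi+1 : lookup w j < lookup w (suc i)
      wj<wi+1 = ℕP.≰⇒> wi+1≰wj
      i+1<j : suc i < j
      i+1<j = ≤∧≢⇒< (subst (ℕ._< toℕ j) (toℕ-inject₁ i) i<j) λ { refl → <-irrefl refl wj<wi+1 }

agreeBelow-later : ∀ {n} (w w′ : Word n) {k : Fin n} → IsPermutation w →
  (∀ {p} → p < k → lookup w p ≡ lookup w′ p) →
  ∀ {s t} → k ≤ s → lookup w′ t ≡ lookup w s → k ≤ t
agreeBelow-later w w′ {k} perm agree {s} {t} k≤s w′t≡ws with t <? k
... | yes t<k = contradiction k≤s (ℕP.<⇒≱ (subst (_< _) (perm t s (trans (agree t<k) w′t≡ws)) t<k))
... | no t≮k  = ℕP.≮⇒≥ t≮k

module _ {m} {h : Hess (ℕ.suc m)} (mono : WeaklyIncreasing h) {o : Orientation (ℕ.suc m)} where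

  -- Let k be the first position where w and w′ differ, with w′ k < w k.  The letter b = w′ k
  -- sits further right in w, so the descent lemma yields an edge {b, c} with c placed by w
  -- between k and b; w′ places b before c instead, so o cannot orient {b, c} for both.
  no-first-descent : ∀ w w′ → TymoczkoExtension h o w → TymoczkoExtension h o w′ →
    ∀ k → (∀ {p} → p < k → lookup w p ≡ lookup w′ p) → ¬ lookup w′ k < lookup w k
  no-first-descent w w′ (le , tym) (le′ , _) k agree w′k<wk =
    refute (descent mono w tym k j k<j (subst (_< lookup w k) (sym wj≡w′k) w′k<wk))
    where
    open Positions w (proj₁ le)
    module P′ = Positions w′ (proj₁ le′)

    j = position (lookup w′ k)
    wj≡w′k : lookup w j ≡ lookup w′ k
    wj≡w′k = lookup-position (lookup w′ k)

    k<j : k < j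
    k<j = ≤∧≢⇒< (agreeBelow-later w′ w (proj₁ le′) (sym ∘ agree) ≤-refl wj≡w′k)
                λ k≡j → <-irrefl (trans (sym wj≡w′k) (cong (lookup w) (sym k≡j))) w′k<wk

    refute : DescentWitness h w k j → ⊥
    refute (s , k≤s , s<j , edge) = contradiction (trans (sym oriented-by-w) oriented-by-w′) λ ()
      where
      t = P′.position (lookup w s)
      w′t≡ws : lookup w′ t ≡ lookup w s
      w′t≡ws = P′.lookup-position (lookup w s)

      k<t : k < t
      k<t = ≤∧≢⇒< (agreeBelow-later w w′ (proj₁ le) agree k≤s w′t≡ws)
                  λ k≡t → <-irrefl (trans wj≡w′k (trans (cong (lookup w′) k≡t) w′t≡ws)) (proj₁ edge)

      oriented-by-w : o (lookup w j) (lookup w s) ≡ false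
      oriented-by-w = trans (orientation-by-order w le j s edge) (dec-false (j <? s) (<-asym s<j))

      oriented-by-w′ : o (lookup w j) (lookup w s) ≡ true
      oriented-by-w′ = subst₂ (λ a b → o a b ≡ true) (sym wj≡w′k) w′t≡ws
        (trans (orientation-by-order w′ le′ k t (subst₂ (Edge h) wj≡w′k (sym w′t≡ws) edge))
               (dec-true (k <? t) k<t))

  tymoczkoExtension-unique : ∀ {w w′} → TymoczkoExtension h o w → TymoczkoExtension h o w′ → w ≡ w′
  tymoczkoExtension-unique {w} {w′} ext ext′ = begin
    w                    ≡⟨ tabulate∘lookup w ⟨
    tabulate (lookup w)  ≡⟨ tabulate-cong (All.wfRec <-wellFounded _ _ agree-at) ⟩
    tabulate (lookup w′) ≡⟨ tabulate∘lookup w′ ⟩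
    w′                   ∎
    where
    open ≡-Reasoning
    agree-at : ∀ k → (∀ {p} → p < k → lookup w p ≡ lookup w′ p) → lookup w k ≡ lookup w′ k
    agree-at k agree with <-cmp (lookup w k) (lookup w′ k)
    ... | tri< wk<w′k _ _ = contradiction wk<w′k (no-first-descent w′ w ext′ ext k (sym ∘ agree))
    ... | tri≈ _ wk≡w′k _ = wk≡w′k
    ... | tri> _ _ w′k<wk = contradiction w′k<wk (no-first-descent w w′ ext ext′ k agree)

-- The dimension formula

module Dimension {m} {h : Hess (ℕ.suc m)} (diag : ∀ i → i ≤ h i) {o : Orientation (ℕ.suc m)}
                 (w : Word (ℕ.suc m)) (le : LinearExtension h o w) (tym : Tymoczko h w) where

  open Positions w (proj₁ le)

  W : Fin (ℕ.suc m) → Fin (ℕ.suc m)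
  W = lookup w

  top : Fin (ℕ.suc m)
  top = fromℕ m

  atMostBefore : Fin (ℕ.suc m) → Fin (ℕ.suc m) → ℕ
  atMostBefore a X = countBefore a (λ b → W b ≤? X)

  largerBefore : Fin (ℕ.suc m) → Fin (ℕ.suc m) → ℕ
  largerBefore a X = countBefore a (λ b → (W a <? W b) ×-dec (W b ≤? X))

  smallerBefore : Fin (ℕ.suc m) → ℕ
  smallerBefore a = atMostBefore a (W a)

  atMostBefore-split : ∀ a {X} → W a ≤ X → atMostBefore a X ≡ smallerBefore a + largerBefore a X
  atMostBefore-split a Wa≤X = countBefore-split W Wa≤X a

  tymoczko-step : ∀ a → W (inject₁ a) ≤ h (W (suc a))
  tymoczko-step a = proj₂ tym (inject₁ a) (suc a) (next-inject₁ a)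

  atMostBefore-next : Fin m → ℕ
  atMostBefore-next a = atMostBefore (inject₁ a) (h (W (suc a)))

  largerBefore-next : Fin m → ℕ
  largerBefore-next a = largerBefore (inject₁ a) (h (W (suc a)))

  descendingEdges-at : ∀ a → ∑[ b < _ ] 𝟙 (descending? h o (W a , W b)) ≡ largerBefore a (h (W a))
  descendingEdges-at a = sum-cong-≗ λ b → 𝟙-cong (mk⇔
      (λ (edge , reversed) → proj₂ le b a [ inj₂ (edge , reversed) ] , edge)
      (λ (b<a , edge) → edge , trans (orientation-by-order w le a b edge) (dec-false (a <? b) (<-asym b<a))))
    (descending? h o (W a , W b)) ((b <? a) ×-dec ((W a <? W b) ×-dec (W b ≤? h (W a))))

  hInversions-at : ∀ a → ∑[ b < _ ] 𝟙 (hInversion? h w (b , inject₁ a)) ≡ largerBefore-next a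
  hInversions-at a = sum-cong-≗ λ b → 𝟙-cong (mk⇔
      (λ (b<a , descent , bounded) → b<a , descent , bounded (suc a) (next-inject₁ a))
      (λ (b<a , descent , bound) → b<a , descent , λ r next →
        subst (λ r → W b ≤ h (W r)) (toℕ-injective (trans (sym (next-inject₁ a)) next)) bound))
    (hInversion? h w (b , inject₁ a))
    ((b <? inject₁ a) ×-dec ((W (inject₁ a) <? W b) ×-dec (W b ≤? h (W (suc a)))))

  hInversions-at-top : ∑[ b < _ ] 𝟙 (hInversion? h w (b , top)) ≡ largerBefore top top
  hInversions-at-top = sum-cong-≗ λ b → 𝟙-cong (mk⇔
      (λ (b<top , descent , _) → b<top , descent , ≤fromℕ (W b))
      (λ (b<top , descent , _) → b<top , descent , λ r next →
        contradiction (toℕ<n r) (ℕP.<-irrefl (trans (sym next) (cong ℕ.suc (toℕ-fromℕ m))))))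
    (hInversion? h w (b , top)) ((b <? top) ×-dec ((W top <? W b) ×-dec (W b ≤? top)))

  reindex : (g : Fin (ℕ.suc m) → ℕ) → sum g ≡ sum (g ∘ W)
  reindex g = sum-permute g (permutation W position lookup-position position-lookup)

  descendingEdges-by-position : descendingEdges h o ≡ ∑[ a < _ ] largerBefore a (h (W a))
  descendingEdges-by-position = begin
    descendingEdges h o
      ≡⟨ count-cartesianProduct (descending? h o) id id ⟩
    ∑[ i < _ ] ∑[ j < _ ] 𝟙 (descending? h o (i , j))
      ≡⟨ sum-cong-≗ (λ i → reindex (λ j → 𝟙 (descending? h o (i , j)))) ⟩
    ∑[ i < _ ] ∑[ b < _ ] 𝟙 (descending? h o (i , W b))
      ≡⟨ reindex (λ i → ∑[ b < _ ] 𝟙 (descending? h o (i , W b))) ⟩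
    ∑[ a < _ ] ∑[ b < _ ] 𝟙 (descending? h o (W a , W b))
      ≡⟨ sum-cong-≗ descendingEdges-at ⟩
    ∑[ a < _ ] largerBefore a (h (W a)) ∎
    where open ≡-Reasoning

  hinv-by-position : hinv h w ≡ sum largerBefore-next + largerBefore top top
  hinv-by-position = begin
    hinv h w
      ≡⟨ count-cartesianProduct (hInversion? h w) id id ⟩
    ∑[ b < _ ] ∑[ a < _ ] 𝟙 (hInversion? h w (b , a))
      ≡⟨ ∑-comm (λ b a → 𝟙 (hInversion? h w (b , a))) ⟩
    ∑[ a < _ ] ∑[ b < _ ] 𝟙 (hInversion? h w (b , a))
      ≡⟨ sum-init-last (λ a → ∑[ b < _ ] 𝟙 (hInversion? h w (b , a))) ⟩
    ∑[ a < m ] ∑[ b < _ ] 𝟙 (hInversion? h w (b , inject₁ a))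
      + ∑[ b < _ ] 𝟙 (hInversion? h w (b , top))
      ≡⟨ cong₂ _+_ (sum-cong-≗ hInversions-at) hInversions-at-top ⟩
    sum largerBefore-next + largerBefore top top ∎
    where open ≡-Reasoning

  descending-total : sum smallerBefore + descendingEdges h o ≡ sum atMostBefore-next + m
  descending-total = begin
    sum smallerBefore + descendingEdges h o
      ≡⟨ cong (sum smallerBefore +_) descendingEdges-by-position ⟩
    sum smallerBefore + ∑[ a < _ ] largerBefore a (h (W a))
      ≡⟨ ∑-distrib-+ smallerBefore (λ a → largerBefore a (h (W a))) ⟨
    ∑[ a < _ ] (smallerBefore a + largerBefore a (h (W a)))
      ≡⟨ sum-cong-≗ (λ a → atMostBefore-split a (diag (W a))) ⟨
    ∑[ a < _ ] atMostBefore a (h (W a))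
      ≡⟨ ∑-shift (λ a → atMostBefore a (h (W a))) atMostBefore-next
           (countBefore-zero (λ b → W b ≤? h (W zero))) shift ⟩
    sum atMostBefore-next + m ∎
    where
    open ≡-Reasoning
    shift : ∀ a → atMostBefore (suc a) (h (W (suc a))) ≡ atMostBefore-next a + 1
    shift a = trans (countBefore-suc (λ b → W b ≤? h (W (suc a))) a)
                    (cong (atMostBefore-next a +_)
                          (𝟙-yes (W (inject₁ a) ≤? h (W (suc a))) (tymoczko-step a)))

  hInversion-total : sum smallerBefore + hinv h w ≡ sum atMostBefore-next + m
  hInversion-total = begin
    sum smallerBefore + hinv h w
      ≡⟨ cong (sum smallerBefore +_) hinv-by-position ⟩
    sum smallerBefore + (sum largerBefore-next + largerBefore top top)
      ≡⟨ cong (_+ (sum largerBefore-next + largerBefore top top)) (sum-init-last smallerBefore) ⟩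
    (sum (smallerBefore ∘ inject₁) + smallerBefore top) + (sum largerBefore-next + largerBefore top top)
      ≡⟨ interchange (sum (smallerBefore ∘ inject₁)) _ _ _ ⟩
    (sum (smallerBefore ∘ inject₁) + sum largerBefore-next) + (smallerBefore top + largerBefore top top)
      ≡⟨ cong₂ _+_ (∑-distrib-+ (smallerBefore ∘ inject₁) largerBefore-next)
                   (atMostBefore-split top (≤fromℕ _)) ⟨
    ∑[ a < m ] (smallerBefore (inject₁ a) + largerBefore-next a) + atMostBefore top top
      ≡⟨ cong₂ _+_ (sym (sum-cong-≗ (λ a → atMostBefore-split (inject₁ a) (tymoczko-step a))))
                   (countBefore-all (λ b → W b ≤? top) (λ b → ≤fromℕ (W b)) top) ⟩
    sum atMostBefore-next + toℕ top
      ≡⟨ cong (sum atMostBefore-next +_) (toℕ-fromℕ m) ⟩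
    sum atMostBefore-next + m ∎
    where open ≡-Reasoning

  hinv≡descendingEdges : hinv h w ≡ descendingEdges h o
  hinv≡descendingEdges =
    ℕP.+-cancelˡ-≡ (sum smallerBefore) _ _ (trans hInversion-total (sym descending-total))

mainTheorem1 : (n : ℕ) → n ≥ 1 → (h : Hess n) → WeaklyIncreasing h → (∀ i → i ≤ h i) →
    -- existence and uniqueness of σ_o
    (∀ o → Acyclic h o → ∃! _≡_ (λ w → LinearExtension h o w × Tymoczko h w))
    -- injectivity of o ↦ σ_o (orientations compared on edges)
    × (∀ o o′ w → Acyclic h o → Acyclic h o′ →
        LinearExtension h o w → LinearExtension h o′ w → Tymoczko h w →
        SameOrientation h o o′)
    -- surjectivity onto Tymoczko configurations
    × (∀ w → Tymoczko h w → ∃ (λ o → Acyclic h o × LinearExtension h o w))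
    -- dimension statement
    × (∀ o w → Acyclic h o → LinearExtension h o w → Tymoczko h w →
        hinv h w ≡ descendingEdges h o)
mainTheorem1 (ℕ.suc m) _ h mono diag =
  (λ o acyclic → let (w , ext) = tymoczkoExtension-exists diag acyclic in
     w , ext , tymoczkoExtension-unique mono ext) ,
  (λ o o′ w _ _ le le′ _ → linearExtensions-agree w le le′) ,
  (λ w tym → permutation⇒linearExtension h w (proj₁ tym)) ,
  (λ o w _ le tym → Dimension.hinv≡descendingEdges diag w le tym)
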